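{- Let $p=p[1\ldots m]$ and $t=t[1\ldots n]$ be sequences of pairwise distinct integers, let $1\le j\le n-m+2$ and $x=t[j\ldots j+m-2]$ (of length $m-1$). Let $\ell=\mathrm{lcp}(\overrightarrow{PD}_p,\overrightarrow{PD}_x)$ and $r=\mathrm{lcs}(\overleftarrow{PD}_p,\overleftarrow{PD}_x)$. If $\ell+r\ge m-1$, then $p\overset{\textsc{DEL}}{\approx}_{CT} x$.
   Context: The Cartesian tree $C(x)$ of a sequence $x$ has as root the position $g$ of its minimum, left subtree $C(x[1\ldots g-1])$ and right subtree the Cartesian tree of the part after $g$; $u\approx_{CT} v$ means $C(u)=C(v)$ (empty sequences match). $\overrightarrow{PD}_x[h]=h-\max\{k<h: x[k]<x[h]\}$ if such $k$ exists and $0$ otherwise; $\overleftarrow{PD}_x[h]=\min\{k>h: x[k]<x[h]\}-h$ if such $k$ exists and $0$ otherwise. $\mathrm{lcp}(u,v)$ and $\mathrm{lcs}(u,v)$ are the lengths of the longest common prefix and longest common suffix of sequences $u,v$ (possibly of different lengths). For $x$ of length $m$ and $y$ of length $m-1$, $x\overset{\textsc{DEL}}{\approx}_{CT} y$ means there exists $h$ with $x[1\ldots h]\approx_{CT} y[1\ldots h]$ and $x[h+2\ldots m]\approx_{CT} y[h+1\ldots m-1]$. -}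

module Defs where

open import Data.Nat using (ℕ; zero; suc; _≡ᵇ_)
open import Data.Integer using (ℤ; _<?_; _≤?_)
open import Data.List using (List; []; _∷_; take; drop; length; reverse)
open import Data.Bool using (if_then_else_)
open import Data.Product using (∃-syntax; _×_)
open import Relation.Nullary.Decidable using (⌊_⌋)
open import Relation.Binary.PropositionalEquality using (_≡_)

-- Sequences are lists of integers; positions are 1-based in the paper.

-- Binary trees whose nodes carry the (1-based, relative) position of the root.
data Tree : Set where
  leaf : Tree
  node : Tree → ℕ → Tree → Tree

-- 0-based index of the (first) minimum of  v ∷ xs
-- minAux bestVal bestIdx curIdx rest
minAux : ℤ → ℕ → ℕ → List ℤ → ℕ
minAux b bi ci [] = bi
minAux b bi ci (y ∷ ys) =
  if ⌊ y <? b ⌋ then minAux y ci (suc ci) ys else minAux b bi (suc ci) ys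

minIdx : ℤ → List ℤ → ℕ
minIdx v xs = minAux v 0 1 xs

-- Cartesian tree with fuel (fuel = length suffices)
ctFuel : ℕ → List ℤ → Tree
ctFuel _ [] = leaf
ctFuel zero (_ ∷ _) = leaf
ctFuel (suc f) (v ∷ xs) =
  let g = minIdx v xs
      ys = v ∷ xs
  in node (ctFuel f (take g ys)) (suc g) (ctFuel f (drop (suc g) ys))

CT : List ℤ → Tree
CT x = ctFuel (length x) x

_≈CT_ : List ℤ → List ℤ → Set
u ≈CT v = CT u ≡ CT v

-- distance (1-based) to the first element of the list smaller than v, 0 if none
firstSmaller : ℤ → List ℤ → ℕ
firstSmaller v [] = 0
firstSmaller v (y ∷ ys) with ⌊ y <? v ⌋ | firstSmaller v ys
... | Data.Bool.true  | _ = 1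
... | Data.Bool.false | zero = 0
... | Data.Bool.false | suc k = suc (suc k)

fwdPDAux : List ℤ → List ℤ → List ℕ
fwdPDAux rev [] = []
fwdPDAux rev (y ∷ ys) = firstSmaller y rev ∷ fwdPDAux (y ∷ rev) ys

fwdPD : List ℤ → List ℕ
fwdPD x = fwdPDAux [] x

bwdPD : List ℤ → List ℕ
bwdPD [] = []
bwdPD (y ∷ ys) = firstSmaller y ys ∷ bwdPD ys

lcp : List ℕ → List ℕ → ℕ
lcp (a ∷ as) (b ∷ bs) = if a ≡ᵇ b then suc (lcp as bs) else 0
lcp _ _ = 0

lcs : List ℕ → List ℕ → ℕ
lcs u v = lcp (reverse u) (reverse v)

_DEL≈CT_ : List ℤ → List ℤ → Set
x DEL≈CT y = ∃[ h ] ((take h x ≈CT take h y) × (drop (suc h) x ≈CT drop h y))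

{-# OPTIONS --safe #-}
module Submission where

-- Each of the two distance arrays determines the Cartesian tree of a sequence of distinct
-- values. The root is the last position with →PD entry 0 (nothing smaller to its left) and
-- the first position with ←PD entry 0; the →PD array of a prefix is a prefix of →PD, and
-- that of a suffix is the matching suffix of →PD with distances pointing out of it reset
-- to 0 (symmetrically for ←PD). So equal arrays give equal trees, by induction on the tree.
-- Taking h = ℓ, the prefixes of length ℓ of p and x have equal →PD arrays, and r ≥ m-1-ℓ
-- says that p[ℓ+2..m] and x[ℓ+1..m-1] have equal ←PD arrays.

open import Defs
open import Data.Nat using (ℕ; _+_; _∸_; _≤_)
open import Data.Integer using (ℤ)
open import Data.List using (List; take; drop; length)
open import Data.List.Relation.Unary.Unique.Propositional using (Unique)

open import Data.Nat using (zero; suc; z≤n; s≤s; s≤s⁻¹; _≡ᵇ_; _≤ᵇ_; _<ᵇ_)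
import Data.Nat.Properties as ℕₚ
open import Data.Integer using (_<_; _<?_)
import Data.Integer as ℤ
import Data.Integer.Properties as ℤₚ
open import Data.List using ([]; _∷_; _++_; reverse; _ʳ++_)
import Data.List.Properties as Listₚ
open import Data.List.Membership.Propositional using (_∈_)
open import Data.List.Relation.Unary.All as All using (All; []; _∷_)
open import Data.List.Relation.Unary.All.Properties using (¬Any⇒All¬)
open import Data.List.Relation.Unary.Any as Any using (Any; here; there; any?)
open import Data.List.Relation.Unary.AllPairs using (_∷_)
import Data.List.Relation.Unary.Unique.Propositional.Properties as Uniqueₚ
open import Data.Bool using (true; false; if_then_else_; T)
open import Data.Unit using (tt)
open import Data.Product using (_,_)
open import Function using (_∘_; case_of_)
open import Relation.Nullary using (¬_; Dec; yes; no; contradiction)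
open import Relation.Binary.PropositionalEquality
  using (_≡_; refl; sym; trans; cong; cong₂; subst; module ≡-Reasoning)

sucNonZero : ℕ → ℕ
sucNonZero zero    = zero
sucNonZero (suc k) = suc (suc k)

firstSmaller-< : ∀ {v y} ys → y < v → firstSmaller v (y ∷ ys) ≡ 1
firstSmaller-< {v} {y} ys y<v with y <? v
... | yes _   = refl
... | no y≮v = contradiction y<v y≮v

firstSmaller-≮ : ∀ {v y} ys → ¬ y < v → firstSmaller v (y ∷ ys) ≡ sucNonZero (firstSmaller v ys)
firstSmaller-≮ {v} {y} ys y≮v with y <? v | firstSmaller v ys
... | yes y<v | _     = contradiction y<v y≮v
... | no _    | zero  = refl
... | no _    | suc _ = refl

firstSmaller≡0⇒All≮ : ∀ {v} ys → firstSmaller v ys ≡ 0 → All (λ z → ¬ z < v) ys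
firstSmaller≡0⇒All≮ []       _  = []
firstSmaller≡0⇒All≮ {v} (y ∷ ys) eq with y <? v | firstSmaller v ys in rest
firstSmaller≡0⇒All≮ (y ∷ ys) () | yes _  | _
firstSmaller≡0⇒All≮ (y ∷ ys) eq | no y≮v | zero  = y≮v ∷ firstSmaller≡0⇒All≮ ys rest
firstSmaller≡0⇒All≮ (y ∷ ys) () | no _   | suc _

All≮⇒firstSmaller≡0 : ∀ {v} ys → All (λ z → ¬ z < v) ys → firstSmaller v ys ≡ 0
All≮⇒firstSmaller≡0 []       []           = refl
All≮⇒firstSmaller≡0 (y ∷ ys) (y≮v ∷ ys≮v) =
  trans (firstSmaller-≮ ys y≮v) (cong sucNonZero (All≮⇒firstSmaller≡0 ys ys≮v))

clip : ℕ → ℕ → ℕ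
clip n d = if d ≤ᵇ n then d else 0

clip-sucNonZero : ∀ n d → sucNonZero (clip n d) ≡ clip (suc n) (sucNonZero d)
clip-sucNonZero n zero = refl
clip-sucNonZero n (suc k) with k <ᵇ n
... | true  = refl
... | false = refl

clip-0 : ∀ d → clip 0 d ≡ 0
clip-0 zero    = refl
clip-0 (suc d) = refl

firstSmaller-take : ∀ v n ys → firstSmaller v (take n ys) ≡ clip n (firstSmaller v ys)
firstSmaller-take v zero    ys       = sym (clip-0 (firstSmaller v ys))
firstSmaller-take v (suc n) []       = refl
firstSmaller-take v (suc n) (y ∷ ys) = by-cases (y <? v)
  where
  open ≡-Reasoning
  by-cases : Dec (y < v) → firstSmaller v (y ∷ take n ys) ≡ clip (suc n) (firstSmaller v (y ∷ ys))
  by-cases (yes y<v) =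
    trans (firstSmaller-< (take n ys) y<v) (cong (clip (suc n)) (sym (firstSmaller-< ys y<v)))
  by-cases (no y≮v)  = begin
    firstSmaller v (y ∷ take n ys)                ≡⟨ firstSmaller-≮ (take n ys) y≮v ⟩
    sucNonZero (firstSmaller v (take n ys))       ≡⟨ cong sucNonZero (firstSmaller-take v n ys) ⟩
    sucNonZero (clip n (firstSmaller v ys))       ≡⟨ clip-sucNonZero n (firstSmaller v ys) ⟩
    clip (suc n) (sucNonZero (firstSmaller v ys)) ≡⟨ cong (clip (suc n)) (firstSmaller-≮ ys y≮v) ⟨
    clip (suc n) (firstSmaller v (y ∷ ys))        ∎

length-fwdPDAux : ∀ rev u → length (fwdPDAux rev u) ≡ length u
length-fwdPDAux rev []       = refl
length-fwdPDAux rev (y ∷ ys) = cong suc (length-fwdPDAux (y ∷ rev) ys)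

take-fwdPDAux : ∀ n rev u → take n (fwdPDAux rev u) ≡ fwdPDAux rev (take n u)
take-fwdPDAux zero    rev u        = refl
take-fwdPDAux (suc n) rev []       = refl
take-fwdPDAux (suc n) rev (y ∷ ys) = cong (_ ∷_) (take-fwdPDAux n (y ∷ rev) ys)

drop-fwdPDAux : ∀ n rev u → drop n (fwdPDAux rev u) ≡ fwdPDAux (take n u ʳ++ rev) (drop n u)
drop-fwdPDAux zero    rev u        = refl
drop-fwdPDAux (suc n) rev []       = refl
drop-fwdPDAux (suc n) rev (y ∷ ys) = drop-fwdPDAux n (y ∷ rev) ys

clipFrom : ℕ → List ℕ → List ℕ
clipFrom i []       = []
clipFrom i (d ∷ ds) = clip i d ∷ clipFrom (suc i) ds

clipFrom-fwdPDAux : ∀ i rev u → clipFrom i (fwdPDAux rev u) ≡ fwdPDAux (take i rev) u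
clipFrom-fwdPDAux i rev []       = refl
clipFrom-fwdPDAux i rev (y ∷ ys) =
  cong₂ _∷_ (sym (firstSmaller-take y i rev)) (clipFrom-fwdPDAux (suc i) (y ∷ rev) ys)

fwdPD-take : ∀ n u → fwdPD (take n u) ≡ take n (fwdPD u)
fwdPD-take n u = sym (take-fwdPDAux n [] u)

fwdPD-drop : ∀ n u → fwdPD (drop n u) ≡ clipFrom 0 (drop n (fwdPD u))
fwdPD-drop n u = sym (begin
  clipFrom 0 (drop n (fwdPDAux [] u))                 ≡⟨ cong (clipFrom 0) (drop-fwdPDAux n [] u) ⟩
  clipFrom 0 (fwdPDAux (take n u ʳ++ []) (drop n u))  ≡⟨ clipFrom-fwdPDAux 0 _ (drop n u) ⟩
  fwdPDAux [] (drop n u)                              ∎)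
  where open ≡-Reasoning

lastZeroFrom : ℕ → ℕ → List ℕ → ℕ
lastZeroFrom z i []           = z
lastZeroFrom z i (zero  ∷ ds) = lastZeroFrom i (suc i) ds
lastZeroFrom z i (suc _ ∷ ds) = lastZeroFrom z (suc i) ds

lastZero : List ℕ → ℕ
lastZero = lastZeroFrom 0 0

-- b is the minimum of the scanned elements rev; for distinct values, y < b exactly when
-- the →PD entry of y is 0.
minAux≡lastZeroFrom : ∀ {b} bi i rev ys → b ∈ rev → All (b ℤ.≤_) rev → Unique (b ∷ ys) →
                      minAux b bi i ys ≡ lastZeroFrom bi i (fwdPDAux rev ys)
minAux≡lastZeroFrom bi i rev [] _ _ _ = refl
minAux≡lastZeroFrom {b} bi i rev (y ∷ ys) b∈rev b≤rev ((b≢y ∷ b∉ys) ∷ y∉ys ∷ uys) with y <? b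
... | yes y<b
  rewrite All≮⇒firstSmaller≡0 rev (All.map (λ b≤z z<y → ℤₚ.<-asym z<y (ℤₚ.<-≤-trans y<b b≤z)) b≤rev)
  = minAux≡lastZeroFrom i (suc i) (y ∷ rev) ys (here refl)
      (ℤₚ.≤-refl ∷ All.map (ℤₚ.<⇒≤ ∘ ℤₚ.<-≤-trans y<b) b≤rev) (y∉ys ∷ uys)
... | no y≮b with firstSmaller y rev in fs≡ | ℤₚ.≤∧≢⇒< (ℤₚ.≮⇒≥ y≮b) b≢y
...   | zero  | b<y = contradiction b<y (All.lookup (firstSmaller≡0⇒All≮ rev fs≡) b∈rev)
...   | suc _ | b<y =
  minAux≡lastZeroFrom bi (suc i) (y ∷ rev) ys (there b∈rev) (ℤₚ.<⇒≤ b<y ∷ b≤rev) (b∉ys ∷ uys)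

minIdx≡lastZero-fwdPD : ∀ {v xs} → Unique (v ∷ xs) → minIdx v xs ≡ lastZero (fwdPD (v ∷ xs))
minIdx≡lastZero-fwdPD {v} {xs} = minAux≡lastZeroFrom 0 1 (v ∷ []) xs (here refl) (ℤₚ.≤-refl ∷ [])

length-bwdPD : ∀ u → length (bwdPD u) ≡ length u
length-bwdPD []       = refl
length-bwdPD (y ∷ ys) = cong suc (length-bwdPD ys)

takeClipped : ℕ → List ℕ → List ℕ
takeClipped zero    ds       = []
takeClipped (suc n) []       = []
takeClipped (suc n) (d ∷ ds) = clip n d ∷ takeClipped n ds

bwdPD-take : ∀ n u → bwdPD (take n u) ≡ takeClipped n (bwdPD u)
bwdPD-take zero    u        = refl
bwdPD-take (suc n) []       = refl
bwdPD-take (suc n) (y ∷ ys) = cong₂ _∷_ (firstSmaller-take y n ys) (bwdPD-take n ys)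

bwdPD-drop : ∀ n u → bwdPD (drop n u) ≡ drop n (bwdPD u)
bwdPD-drop zero    u        = refl
bwdPD-drop (suc n) []       = refl
bwdPD-drop (suc n) (y ∷ ys) = bwdPD-drop n ys

firstZero : List ℕ → ℕ
firstZero []           = 0
firstZero (zero  ∷ ds) = 0
firstZero (suc _ ∷ ds) = suc (firstZero ds)

minAux-All≮ : ∀ {b} bi i ys → All (λ z → ¬ z < b) ys → minAux b bi i ys ≡ bi
minAux-All≮ bi i []       []            = refl
minAux-All≮ {b} bi i (y ∷ ys) (y≮b ∷ ys≮b) with y <? b
... | yes y<b = contradiction y<b y≮b
... | no _    = minAux-All≮ bi (suc i) ys ys≮b

minAux-+ : ∀ k b bi i ys → minAux b (k + bi) (k + i) ys ≡ k + minAux b bi i ys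
minAux-+ k b bi i []       = refl
minAux-+ k b bi i (y ∷ ys) with y <? b
... | yes _ = trans (cong (λ c → minAux y (k + i) c ys) (sym (ℕₚ.+-suc k i))) (minAux-+ k y i (suc i) ys)
... | no _  = trans (cong (λ c → minAux b (k + bi) c ys) (sym (ℕₚ.+-suc k i))) (minAux-+ k b bi (suc i) ys)

minAux-Any< : ∀ {b} bi i y ys → Any (_< b) (y ∷ ys) → minAux b bi i (y ∷ ys) ≡ i + minIdx y ys
minAux-Any< {b} bi i y ys y∷ys<b with y <? b
minAux-Any< bi i y ys        _                  | yes _ =
  trans (cong₂ (λ c d → minAux y c d ys) (sym (ℕₚ.+-identityʳ i)) (ℕₚ.+-comm 1 i)) (minAux-+ i y 0 1 ys)
minAux-Any< bi i y ys        (here y<b)         | no y≮b = contradiction y<b y≮b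
minAux-Any< {b} bi i y (y′ ∷ ys′) (there ys<b) | no y≮b = begin
  minAux b bi (suc i) (y′ ∷ ys′)  ≡⟨ minAux-Any< bi (suc i) y′ ys′ ys<b ⟩
  suc i + minIdx y′ ys′           ≡⟨ ℕₚ.+-suc i (minIdx y′ ys′) ⟨
  i + suc (minIdx y′ ys′)         ≡⟨ cong (i +_) (minAux-Any< 0 1 y′ ys′ ys<y) ⟨
  i + minIdx y (y′ ∷ ys′)         ∎
  where
  open ≡-Reasoning
  ys<y : Any (_< y) (y′ ∷ ys′)
  ys<y = Any.map (λ z<b → ℤₚ.<-≤-trans z<b (ℤₚ.≮⇒≥ y≮b)) ys<b

minIdx≡firstZero-bwdPD : ∀ v xs → minIdx v xs ≡ firstZero (bwdPD (v ∷ xs))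
minIdx≡firstZero-bwdPD v []       = refl
minIdx≡firstZero-bwdPD v (y ∷ ys) with firstSmaller v (y ∷ ys) in fs≡
... | zero  = minAux-All≮ 0 1 (y ∷ ys) (firstSmaller≡0⇒All≮ (y ∷ ys) fs≡)
... | suc _ with any? (_<? v) (y ∷ ys)
...   | yes y∷ys<v = trans (minAux-Any< 0 1 y ys y∷ys<v) (cong suc (minIdx≡firstZero-bwdPD y ys))
...   | no ¬y∷ys<v = case trans (sym fs≡) fs≡0 of λ ()
  where
  fs≡0 : firstSmaller v (y ∷ ys) ≡ 0
  fs≡0 = All≮⇒firstSmaller≡0 (y ∷ ys) (¬Any⇒All¬ (y ∷ ys) ¬y∷ys<v)

record CTSignature : Set where
  field
    sig        : List ℤ → List ℕ
    length-sig : ∀ u → length (sig u) ≡ length u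
    root       : List ℕ → ℕ
    root-sig   : ∀ {v xs} → Unique (v ∷ xs) → minIdx v xs ≡ root (sig (v ∷ xs))
    left right : ℕ → List ℕ → List ℕ
    sig-take   : ∀ g u → sig (take g u) ≡ left g (sig u)
    sig-drop   : ∀ g u → sig (drop g u) ≡ right g (sig u)

  sig≡⇒length≡ : ∀ {u w} → sig u ≡ sig w → length u ≡ length w
  sig≡⇒length≡ {u} {w} eq = trans (sym (length-sig u)) (trans (cong length eq) (length-sig w))

  sig≡⇒sig-take≡ : ∀ g {u w} → sig u ≡ sig w → sig (take g u) ≡ sig (take g w)
  sig≡⇒sig-take≡ g {u} {w} eq = trans (sig-take g u) (trans (cong (left g) eq) (sym (sig-take g w)))

  sig≡⇒sig-drop≡ : ∀ g {u w} → sig u ≡ sig w → sig (drop g u) ≡ sig (drop g w)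
  sig≡⇒sig-drop≡ g {u} {w} eq = trans (sig-drop g u) (trans (cong (right g) eq) (sym (sig-drop g w)))

  sig≡⇒ctFuel≡ : ∀ f {u w} → Unique u → Unique w → sig u ≡ sig w → ctFuel f u ≡ ctFuel f w
  sig≡⇒ctFuel≡ f       {[]}    {[]}    _  _  _  = refl
  sig≡⇒ctFuel≡ f       {[]}    {_ ∷ _} _  _  eq = case sig≡⇒length≡ eq of λ ()
  sig≡⇒ctFuel≡ f       {_ ∷ _} {[]}    _  _  eq = case sig≡⇒length≡ eq of λ ()
  sig≡⇒ctFuel≡ zero    {_ ∷ _} {_ ∷ _} _  _  _  = refl
  sig≡⇒ctFuel≡ (suc f) {u@(a ∷ as)} {w@(b ∷ bs)} uu uw eq =
    trans (cong (λ k → nodeAt k u) root≡)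
      (cong₂ (λ l r → node l (suc g) r)
        (sig≡⇒ctFuel≡ f (Uniqueₚ.take⁺ g uu) (Uniqueₚ.take⁺ g uw) (sig≡⇒sig-take≡ g eq))
        (sig≡⇒ctFuel≡ f (Uniqueₚ.drop⁺ (suc g) uu) (Uniqueₚ.drop⁺ (suc g) uw) (sig≡⇒sig-drop≡ (suc g) eq)))
    where
    nodeAt : ℕ → List ℤ → Tree
    nodeAt k v = node (ctFuel f (take k v)) (suc k) (ctFuel f (drop (suc k) v))
    root≡ : minIdx a as ≡ minIdx b bs
    root≡ = trans (root-sig uu) (trans (cong root eq) (sym (root-sig uw)))
    g : ℕ
    g = minIdx b bs

  sig≡⇒≈CT : ∀ {u w} → Unique u → Unique w → sig u ≡ sig w → u ≈CT w
  sig≡⇒≈CT {u} {w} uu uw eq =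
    trans (sig≡⇒ctFuel≡ (length u) uu uw eq) (cong (λ f → ctFuel f w) (sig≡⇒length≡ eq))

fwdPD-signature : CTSignature
fwdPD-signature = record
  { sig        = fwdPD
  ; length-sig = length-fwdPDAux []
  ; root       = lastZero
  ; root-sig   = minIdx≡lastZero-fwdPD
  ; left       = take
  ; right      = λ g → clipFrom 0 ∘ drop g
  ; sig-take   = fwdPD-take
  ; sig-drop   = fwdPD-drop
  }

bwdPD-signature : CTSignature
bwdPD-signature = record
  { sig        = bwdPD
  ; length-sig = length-bwdPD
  ; root       = firstZero
  -- The first minimum is the first position with ←PD entry 0, even with repeated values.
  ; root-sig   = λ {v} {xs} _ → minIdx≡firstZero-bwdPD v xs
  ; left       = takeClipped
  ; right      = drop
  ; sig-take   = bwdPD-take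
  ; sig-drop   = bwdPD-drop
  }

length-take-drop : ∀ {A : Set} i m (t : List A) → i + m ≤ length t → length (take m (drop i t)) ≡ m
length-take-drop zero    zero    t        _           = refl
length-take-drop zero    (suc m) (y ∷ t)  (s≤s i+m≤t) = cong suc (length-take-drop zero m t i+m≤t)
length-take-drop (suc i) m       (y ∷ t)  (s≤s i+m≤t) = length-take-drop i m t i+m≤t

lcp≥⇒take≡ : ∀ as bs {k} → k ≤ lcp as bs → take k as ≡ take k bs
lcp≥⇒take≡ as       bs       {zero}  _ = refl
lcp≥⇒take≡ []       _        {suc k} ()
lcp≥⇒take≡ (_ ∷ _)  []       {suc k} ()
lcp≥⇒take≡ (a ∷ as) (b ∷ bs) {suc k} k<lcp with a ≡ᵇ b in a≡ᵇb
... | true  = cong₂ _∷_ (ℕₚ.≡ᵇ⇒≡ a b (subst T (sym a≡ᵇb) tt)) (lcp≥⇒take≡ as bs (s≤s⁻¹ k<lcp))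
... | false = case k<lcp of λ ()

lcp≤length : ∀ as bs → lcp as bs ≤ length bs
lcp≤length []       bs       = z≤n
lcp≤length (a ∷ as) []       = z≤n
lcp≤length (a ∷ as) (b ∷ bs) with a ≡ᵇ b
... | true  = s≤s (lcp≤length as bs)
... | false = z≤n

take-++-length : ∀ {A : Set} (xs ys : List A) → take (length xs) (xs ++ ys) ≡ xs
take-++-length []       ys = refl
take-++-length (x ∷ xs) ys = cong (x ∷_) (take-++-length xs ys)

drop≡reverse-take-reverse : ∀ {A : Set} (as : List A) i s → length as ≡ i + s → drop i as ≡ reverse (take s (reverse as))
drop≡reverse-take-reverse {A} as i s |as| = sym (begin
  reverse (take s (reverse as))                 ≡⟨ cong (reverse ∘ take s ∘ reverse) (Listₚ.take++drop≡id i as) ⟨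
  reverse (take s (reverse (front ++ back)))    ≡⟨ cong (reverse ∘ take s) (Listₚ.reverse-++ front back) ⟩
  reverse (take s (back′ ++ reverse front))     ≡⟨ cong (λ k → reverse (take k (back′ ++ reverse front))) |back′| ⟨
  reverse (take (length back′) (back′ ++ reverse front)) ≡⟨ cong reverse (take-++-length back′ (reverse front)) ⟩
  reverse back′                                 ≡⟨ Listₚ.reverse-involutive back ⟩
  back                                          ∎)
  where
  open ≡-Reasoning
  front back back′ : List A
  front = take i as
  back  = drop i as
  back′ = reverse back
  |back′| : length back′ ≡ s
  |back′| = begin
    length back′  ≡⟨ Listₚ.length-reverse back ⟩
    length back   ≡⟨ Listₚ.length-drop i as ⟩
    length as ∸ i ≡⟨ cong (_∸ i) |as| ⟩
    i + s ∸ i     ≡⟨ ℕₚ.m+n∸m≡n i s ⟩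
    s             ∎

lcs≥⇒drop≡ : ∀ as bs i j {s} → s ≤ lcs as bs → length as ≡ i + s → length bs ≡ j + s → drop i as ≡ drop j bs
lcs≥⇒drop≡ as bs i j {s} s≤lcs |as| |bs| = begin
  drop i as                      ≡⟨ drop≡reverse-take-reverse as i s |as| ⟩
  reverse (take s (reverse as))  ≡⟨ cong reverse (lcp≥⇒take≡ (reverse as) (reverse bs) s≤lcs) ⟩
  reverse (take s (reverse bs))  ≡⟨ drop≡reverse-take-reverse bs j s |bs| ⟨
  drop j bs                      ∎
  where open ≡-Reasoning

fwdPD≡⇒≈CT : ∀ {u w} → Unique u → Unique w → fwdPD u ≡ fwdPD w → u ≈CT w
fwdPD≡⇒≈CT = CTSignature.sig≡⇒≈CT fwdPD-signature

bwdPD≡⇒≈CT : ∀ {u w} → Unique u → Unique w → bwdPD u ≡ bwdPD w → u ≈CT w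
bwdPD≡⇒≈CT = CTSignature.sig≡⇒≈CT bwdPD-signature

take-≈CT-lcp : ∀ {u w k} → Unique u → Unique w → k ≤ lcp (fwdPD u) (fwdPD w) → take k u ≈CT take k w
take-≈CT-lcp {u} {w} {k} uu uw k≤lcp =
  fwdPD≡⇒≈CT (Uniqueₚ.take⁺ k uu) (Uniqueₚ.take⁺ k uw) (begin
    fwdPD (take k u)  ≡⟨ fwdPD-take k u ⟩
    take k (fwdPD u)  ≡⟨ lcp≥⇒take≡ (fwdPD u) (fwdPD w) k≤lcp ⟩
    take k (fwdPD w)  ≡⟨ fwdPD-take k w ⟨
    fwdPD (take k w)  ∎)
  where open ≡-Reasoning

drop-≈CT-lcs : ∀ {u w} i j {s} → Unique u → Unique w → s ≤ lcs (bwdPD u) (bwdPD w) →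
               length u ≡ i + s → length w ≡ j + s → drop i u ≈CT drop j w
drop-≈CT-lcs {u} {w} i j uu uw s≤lcs |u| |w| =
  bwdPD≡⇒≈CT (Uniqueₚ.drop⁺ i uu) (Uniqueₚ.drop⁺ j uw) (begin
    bwdPD (drop i u)  ≡⟨ bwdPD-drop i u ⟩
    drop i (bwdPD u)  ≡⟨ lcs≥⇒drop≡ (bwdPD u) (bwdPD w) i j s≤lcs
                           (trans (length-bwdPD u) |u|) (trans (length-bwdPD w) |w|) ⟩
    drop j (bwdPD w)  ≡⟨ bwdPD-drop j w ⟨
    bwdPD (drop j w)  ∎)
  where open ≡-Reasoning

lemma23 : (p t : List ℤ) → Unique p → Unique t →
          1 ≤ length p →
          (j : ℕ) → 1 ≤ j → j + length p ≤ length t + 2 →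
          let x = take (length p ∸ 1) (drop (j ∸ 1) t)
          in length p ∸ 1 ≤ lcp (fwdPD p) (fwdPD x) + lcs (bwdPD p) (bwdPD x) →
          p DEL≈CT x
lemma23 p@(_ ∷ ps) t up ut _ (suc j) _ j+|p|≤|t|+2 m≤ℓ+r = ℓ , prefix≈ , suffix≈
  where
  m : ℕ
  m = length ps
  x : List ℤ
  x = take m (drop j t)
  ℓ : ℕ
  ℓ = lcp (fwdPD p) (fwdPD x)
  ux : Unique x
  ux = Uniqueₚ.take⁺ m (Uniqueₚ.drop⁺ j ut)
  j+m≤|t| : j + m ≤ length t
  j+m≤|t| = ℕₚ.+-cancelʳ-≤ 2 (j + m) (length t)
    (subst (_≤ length t + 2) (trans (cong suc (ℕₚ.+-suc j m)) (ℕₚ.+-comm 2 (j + m))) j+|p|≤|t|+2)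
  |x|≡m : length x ≡ m
  |x|≡m = length-take-drop j m t j+m≤|t|
  ℓ≤m : ℓ ≤ m
  ℓ≤m = subst (ℓ ≤_) (trans (length-fwdPDAux [] x) |x|≡m) (lcp≤length (fwdPD p) (fwdPD x))
  ℓ+[m∸ℓ]≡m : ℓ + (m ∸ ℓ) ≡ m
  ℓ+[m∸ℓ]≡m = ℕₚ.m+[n∸m]≡n ℓ≤m
  prefix≈ : take ℓ p ≈CT take ℓ x
  prefix≈ = take-≈CT-lcp up ux ℕₚ.≤-refl
  suffix≈ : drop (suc ℓ) p ≈CT drop ℓ x
  suffix≈ = drop-≈CT-lcs (suc ℓ) ℓ up ux (ℕₚ.m≤n+o⇒m∸n≤o m ℓ m≤ℓ+r)
              (cong suc (sym ℓ+[m∸ℓ]≡m)) (trans |x|≡m (sym ℓ+[m∸ℓ]≡m))
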